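{- Let $a,b$ be primes. The set $\{a,b\}$ is the vertex set inducing a twin exceptional autonomous component in some Goldbach factorization graph $F_n$ if and only if $a,b>2$ and there exist integers $x,y>1$ with $x\neq y$ such that $a^x+b=b^y+a$.
   Context: For an even integer $n\ge 4$, the Goldbach factorization graph is the directed weighted graph $F_n=(V_n,A_n,w_n)$ with vertex set $V_n=[2,n-2]\cap\mathbb{P}$ ($\mathbb{P}$ the set of primes), arc set $A_n=\{(s,t)\in V_n^2 : s \mid (n-t)\}$ (loops allowed), and weights $w_n((s,t))=\max\{e\ge 1: s^e\mid (n-t)\}$. An autonomous component of $F_n$ is a minimal (with respect to inclusion) nonempty subgraph of $F_n$ induced by a vertex set $U\subseteq V_n$ such that $(s,t)\notin A_n$ for every $s\in V_n\setminus U$ and $t\in U$. A Goldbach autonomous component (GAC) is an autonomous component induced by vertices $v_1,v_2\in V_n$ with $v_1+v_2=n$ (a single vertex if $v_1=v_2$). A trivial autonomous component (TAC) is an autonomous component induced by a single vertex that is not a GAC. An exceptional autonomous component (EAC) is an autonomous component that is neither a TAC nor a GAC. A twin EAC is an EAC induced by exactly two vertices. -}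

module Defs where

open import Data.Nat using (ℕ; _+_; _∸_; _≤_)
open import Data.Nat.Divisibility using (_∣_)
open import Data.Nat.Primality using (Prime)
open import Data.Product using (_×_; ∃; ∃-syntax)
open import Data.Sum using (_⊎_)
open import Relation.Binary.PropositionalEquality using (_≡_; _≢_)
open import Relation.Nullary using (¬_)
open import Function.Bundles using (_⇔_)
open import Level using (0ℓ) renaming (suc to lsuc)

Vertex : ℕ → ℕ → Set
Vertex n p = Prime p × 2 ≤ p × p + 2 ≤ n

Arc : ℕ → ℕ → ℕ → Set
Arc n s t = Vertex n s × Vertex n t × s ∣ (n ∸ t)

VSet : Set₁
VSet = ℕ → Set

_⊆_ : VSet → VSet → Set
U ⊆ W = ∀ v → U v → W v

_≐_ : VSet → VSet → Set
U ≐ W = ∀ v → U v ⇔ W v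

Single : ℕ → VSet
Single a v = v ≡ a

Pair : ℕ → ℕ → VSet
Pair a b v = v ≡ a ⊎ v ≡ b

IsClosed : ℕ → VSet → Set
IsClosed n U = (U ⊆ Vertex n) × (∃[ v ] U v) × (∀ s t → Arc n s t → U t → U s)

IsAutonomousComponent : ℕ → VSet → Set₁
IsAutonomousComponent n U = IsClosed n U × (∀ W → IsClosed n W → W ⊆ U → U ⊆ W)

IsGAC : ℕ → VSet → Set₁
IsGAC n U = IsAutonomousComponent n U × (∃[ v₁ ] ∃[ v₂ ] (v₁ + v₂ ≡ n × U ≐ Pair v₁ v₂))

IsTAC : ℕ → VSet → Set₁
IsTAC n U = IsAutonomousComponent n U × (∃[ v ] U ≐ Single v) × ¬ IsGAC n U

IsEAC : ℕ → VSet → Set₁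
IsEAC n U = IsAutonomousComponent n U × ¬ IsTAC n U × ¬ IsGAC n U

IsTwinEAC : ℕ → VSet → Set₁
IsTwinEAC n U = IsEAC n U × (∃[ u ] ∃[ v ] (u ≢ v × U ≐ Pair u v))

-- If {a, b} (a ≠ b) is an autonomous component of F_n, minimality forces the arcs b → a and
-- a → b, i.e. b ∣ n − a and a ∣ n − b; hence neither a nor b divides n, so both are odd when n
-- is even. Every prime factor p of n − a gives an arc p → a, so closedness makes b the only prime
-- factor of n − a, and likewise for n − b: n = b ^ j + a = a ^ k + b. An exponent 1 would make
-- {a, b} a Goldbach component, and j ≠ k because a ^ k + b < b ^ k + a whenever a < b and k ≥ 2.
-- Conversely, n = a ^ x + b = b ^ y + a realises {a, b} as a twin exceptional component.
module Submission where

open import Data.List using ([]; _∷_; length)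
open import Data.List.Relation.Unary.All using (All; []; _∷_)
open import Data.Nat
  using (ℕ; zero; suc; _+_; _*_; _∸_; _^_; _%_; _≤_; _<_; NonZero; >-nonZero; nonTrivial⇒n>1; z≤n; s≤s; z<s)
open import Data.Nat.DivMod using (m%n<n; %-distribˡ-+)
open import Data.Nat.Divisibility
  using (_∣_; _∣?_; ∣-refl; ∣-reflexive; ∣-trans; ∣⇒≤; ∣1⇒≡1; m∣m*n; n∣m*n; ∣m+n∣m⇒∣n; ∣m∸n∣n⇒∣m; m%n≡0⇒n∣m)
open import Data.Nat.ListAction using (product)
open import Data.Nat.Primality
  using (Prime; prime[2]; ¬prime[1]; prime⇒nonZero; prime⇒nonTrivial; prime⇒irreducible; euclidsLemma)
open import Data.Nat.Primality.Factorisation using (PrimeFactorisation; factorise)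
open import Data.Nat.Properties
open import Data.Product using (_×_; _,_; proj₂; ∃-syntax)
open import Data.Sum using (_⊎_; inj₁; inj₂; [_,_]′) renaming (swap to ⊎-swap)
open import Function using (id; _∘_)
open import Function.Bundles using (_⇔_; mk⇔; Equivalence)
open import Relation.Binary.Definitions using (tri<; tri≈; tri>)
open import Relation.Binary.PropositionalEquality
  using (_≡_; _≢_; refl; sym; trans; cong; cong₂; subst; ≢-sym; module ≡-Reasoning)
open import Relation.Nullary using (¬_; yes; no; contradiction)

open import Defs

prime⇒>1 : ∀ {p} → Prime p → 1 < p
prime⇒>1 {p} pp = nonTrivial⇒n>1 p {{prime⇒nonTrivial pp}}

prime∣prime⇒≡ : ∀ {p q} → Prime p → Prime q → p ∣ q → p ≡ q
prime∣prime⇒≡ pp pq p∣q with prime⇒irreducible pq p∣q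
... | inj₁ refl = contradiction pp ¬prime[1]
... | inj₂ p≡q  = p≡q

prime∣^⇒≡ : ∀ {p q} k → Prime p → Prime q → p ∣ q ^ k → p ≡ q
prime∣^⇒≡ zero    pp pq p∣1 = contradiction (subst Prime (∣1⇒≡1 p∣1) pp) ¬prime[1]
prime∣^⇒≡ {q = q} (suc k) pp pq p∣q^k+1 with euclidsLemma q (q ^ k) pp p∣q^k+1
... | inj₁ p∣q   = prime∣prime⇒≡ pp pq p∣q
... | inj₂ p∣q^k = prime∣^⇒≡ k pp pq p∣q^k

^-injectiveʳ : ∀ {m x y} → 1 < m → m ^ x ≡ m ^ y → x ≡ y
^-injectiveʳ {m} {x} {y} 1<m eq with <-cmp x y
... | tri< x<y _ _ = contradiction eq (<⇒≢ (^-monoʳ-< m 1<m x<y))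
... | tri≈ _ x≡y _ = x≡y
... | tri> _ _ y<x = contradiction (sym eq) (<⇒≢ (^-monoʳ-< m 1<m y<x))

product≡^length : ∀ {m q} ps → All Prime ps → product ps ∣ m →
  (∀ p → Prime p → p ∣ m → p ≡ q) → product ps ≡ q ^ length ps
product≡^length []       []         _  _    = refl
product≡^length (p ∷ ps) (pp ∷ pps) ∣m sole = cong₂ _*_
  (sole p pp (∣-trans (m∣m*n (product ps)) ∣m))
  (product≡^length ps pps (∣-trans (n∣m*n p) ∣m) sole)

sole-prime-divisor⇒≡^ : ∀ {m q} .{{_ : NonZero m}} →
  (∀ p → Prime p → p ∣ m → p ≡ q) → ∃[ k ] m ≡ q ^ k
sole-prime-divisor⇒≡^ {m} sole = length factors ,
  trans isFactorisation
    (product≡^length factors factorsPrime (∣-reflexive (sym isFactorisation)) sole)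
  where open PrimeFactorisation (factorise m)

^+<^+ : ∀ {a b k} → a < b → 1 < b → 1 < k → a ^ k + b < b ^ k + a
^+<^+ {a} {b} {suc m} a<b 1<b (s≤s 0<m) = begin-strict
  a * a ^ m + b                    ≡⟨ cong (a * a ^ m +_) (sym (m+[n∸m]≡n (<⇒≤ a<b))) ⟩
  a * a ^ m + (a + d)              ≡⟨ cong (a * a ^ m +_) (+-comm a d) ⟩
  a * a ^ m + (d + a)              ≡⟨ +-assoc (a * a ^ m) d a ⟨
  a * a ^ m + d + a                <⟨ +-monoˡ-< a (+-mono-≤-< a*a^m≤a*b^m d<d*b^m) ⟩
  a * b ^ m + d * b ^ m + a        ≡⟨ cong (_+ a) (*-distribʳ-+ (b ^ m) a d) ⟨
  (a + d) * b ^ m + a              ≡⟨ cong (λ c → c * b ^ m + a) (m+[n∸m]≡n (<⇒≤ a<b)) ⟩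
  b * b ^ m + a                    ∎
  where
  open ≤-Reasoning
  d : ℕ
  d = b ∸ a
  instance _ = >-nonZero (m<n⇒0<n∸m a<b)
  a*a^m≤a*b^m : a * a ^ m ≤ a * b ^ m
  a*a^m≤a*b^m = *-monoʳ-≤ a (^-monoˡ-≤ m (<⇒≤ a<b))
  d<d*b^m : d < d * b ^ m
  d<d*b^m = m<m*n d (b ^ m) (^-monoʳ-< b 1<b 0<m)

^+≢^+ : ∀ {a b k} → 0 < a → 0 < b → a ≢ b → 1 < k → a ^ k + b ≢ b ^ k + a
^+≢^+ {a} {b} 0<a 0<b a≢b 1<k with <-cmp a b
... | tri< a<b _ _ = <⇒≢ (^+<^+ a<b (≤-<-trans 0<a a<b) 1<k)
... | tri≈ _ a≡b _ = contradiction a≡b a≢b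
... | tri> _ _ b<a = ≢-sym (<⇒≢ (^+<^+ b<a (≤-<-trans 0<b b<a) 1<k))

odd⇒%2≡1 : ∀ {m} → ¬ 2 ∣ m → m % 2 ≡ 1
odd⇒%2≡1 {m} ¬2∣m with m % 2 in eq | m%n<n m 2
... | 0           | _               = contradiction (m%n≡0⇒n∣m m 2 eq) ¬2∣m
... | 1           | _               = refl
... | suc (suc _) | s≤s (s≤s ())

odd+odd⇒even : ∀ {m n} → ¬ 2 ∣ m → ¬ 2 ∣ n → 2 ∣ m + n
odd+odd⇒even {m} {n} ¬2∣m ¬2∣n = m%n≡0⇒n∣m (m + n) 2 (begin
  (m + n) % 2          ≡⟨ %-distribˡ-+ m n 2 ⟩
  (m % 2 + n % 2) % 2  ≡⟨ cong₂ (λ r s → (r + s) % 2) (odd⇒%2≡1 ¬2∣m) (odd⇒%2≡1 ¬2∣n) ⟩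
  0                    ∎)
  where open ≡-Reasoning

odd-prime⇒odd : ∀ {p} → Prime p → 2 < p → ¬ 2 ∣ p
odd-prime⇒odd pp 2<p = <⇒≢ 2<p ∘ prime∣prime⇒≡ prime[2] pp

odd-prime^⇒odd : ∀ {p} k → Prime p → 2 < p → ¬ 2 ∣ p ^ k
odd-prime^⇒odd k pp 2<p = <⇒≢ 2<p ∘ prime∣^⇒≡ k prime[2] pp

prime∤even⇒>2 : ∀ {p n} → Prime p → 2 ∣ n → ¬ p ∣ n → 2 < p
prime∤even⇒>2 {n = n} pp 2∣n p∤n = ≤∧≢⇒< (prime⇒>1 pp) (λ 2≡p → p∤n (subst (_∣ n) 2≡p 2∣n))

m∣m^ : ∀ m {k} → 0 < k → m ∣ m ^ k
m∣m^ m {suc k} _ = m∣m*n (m ^ k)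

Vertex⇒≤ : ∀ {n v} → Vertex n v → v ≤ n
Vertex⇒≤ {v = v} (_ , _ , v+2≤n) = ≤-trans (m≤m+n v 2) v+2≤n

Vertex⇒1<∸ : ∀ {n v} → Vertex n v → 1 < n ∸ v
Vertex⇒1<∸ {n} {v} (_ , _ , v+2≤n) = subst (_≤ n ∸ v) (m+n∸m≡n v 2) (∸-monoˡ-≤ v v+2≤n)

+≡⇒Vertex : ∀ {n c v} → Prime v → 1 < c → c + v ≡ n → Vertex n v
+≡⇒Vertex {c = c} {v} pv 1<c c+v≡n =
  pv , prime⇒>1 pv , subst (v + 2 ≤_) (trans (+-comm v c) c+v≡n) (+-monoʳ-≤ v 1<c)

+≡⇒∸≡ : ∀ {n c v} → c + v ≡ n → n ∸ v ≡ c
+≡⇒∸≡ {c = c} {v} refl = m+n∸n≡m c v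

∣⇒Arc : ∀ {n s t} → Prime s → Vertex n t → s ∣ n ∸ t → Arc n s t
∣⇒Arc {n} {s} {t} ps vt@(_ , 2≤t , _) s∣n∸t = (ps , prime⇒>1 ps , s+2≤n) , vt , s∣n∸t
  where
  instance _ = >-nonZero (<-trans z<s (Vertex⇒1<∸ vt))
  s+2≤n : s + 2 ≤ n
  s+2≤n = ≤-trans (+-mono-≤ (∣⇒≤ s∣n∸t) 2≤t) (≤-reflexive (m∸n+n≡m (Vertex⇒≤ vt)))

∣∸Vertex⇒∤ : ∀ {n a b} → Prime a → Prime b → a ≢ b → Vertex n b → a ∣ n ∸ b → ¬ a ∣ n
∣∸Vertex⇒∤ pa pb a≢b vb a∣n∸b a∣n = a≢b (prime∣prime⇒≡ pa pb
  (∣m+n∣m⇒∣n (subst (_ ∣_) (sym (m∸n+n≡m (Vertex⇒≤ vb))) a∣n) a∣n∸b))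

Pair-diagonal : ∀ {a v} → Pair a a v → v ≡ a
Pair-diagonal = [ id , id ]′

Pair≐Pair⇒+≡ : ∀ {a b c d} → Pair a b ≐ Pair c d → a + b ≡ c + d
Pair≐Pair⇒+≡ {a} {b} {c} {d} ab≐cd
  with Equivalence.to (ab≐cd a) (inj₁ refl) | Equivalence.to (ab≐cd b) (inj₂ refl)
... | inj₁ refl | inj₂ refl = refl
... | inj₂ refl | inj₁ refl = +-comm d c
... | inj₁ refl | inj₁ refl = cong (c +_) (sym (Pair-diagonal (Equivalence.from (ab≐cd d) (inj₂ refl))))
... | inj₂ refl | inj₂ refl = cong (_+ d) (sym (Pair-diagonal (Equivalence.from (ab≐cd c) (inj₁ refl))))

Pair≐Pair⇒≢ : ∀ {a b u v} → u ≢ v → Pair a b ≐ Pair u v → a ≢ b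
Pair≐Pair⇒≢ {u = u} {v} u≢v ab≐uv refl =
  u≢v (trans (Pair-diagonal (Equivalence.from (ab≐uv u) (inj₁ refl)))
             (sym (Pair-diagonal (Equivalence.from (ab≐uv v) (inj₂ refl)))))

Pair≐Single⇒≡ : ∀ {a b v} → Pair a b ≐ Single v → a ≡ b
Pair≐Single⇒≡ {a} {b} ab≐v =
  trans (Equivalence.to (ab≐v a) (inj₁ refl)) (sym (Equivalence.to (ab≐v b) (inj₂ refl)))

Pair-IsGAC⇔ : ∀ {n a b} → IsAutonomousComponent n (Pair a b) → IsGAC n (Pair a b) ⇔ a + b ≡ n
Pair-IsGAC⇔ {a = a} {b} component = mk⇔
  (λ { (_ , _ , _ , c+d≡n , ab≐cd) → trans (Pair≐Pair⇒+≡ ab≐cd) c+d≡n })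
  (λ a+b≡n → component , a , b , a+b≡n , λ _ → mk⇔ id id)

pair-component⇒∣ : ∀ {n a b} {U : VSet} → IsAutonomousComponent n U →
  U ⊆ Pair a b → U a → U b → a ≢ b → b ∣ n ∸ a
pair-component⇒∣ {n} {a} {b} ((U⊆V , _ , closedU) , minimal) U⊆ab Ua Ub a≢b
  with b ∣? n ∸ a
... | yes b∣n∸a = b∣n∸a
... | no  b∤n∸a = contradiction (sym (minimal (Single a) a-closed (λ { _ refl → Ua }) b Ub)) a≢b
  where
  into-a : ∀ s t → Arc n s t → Single a t → Single a s
  into-a s _ arc refl with U⊆ab s (closedU s a arc Ua)
  ... | inj₁ s≡a = s≡a
  ... | inj₂ refl = contradiction (proj₂ (proj₂ arc)) b∤n∸a
  a-closed : IsClosed n (Single a)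
  a-closed = (λ { _ refl → U⊆V a Ua }) , (a , refl) , into-a

in-arcs⇒∸≡^ : ∀ {n a b} → Prime a → Vertex n a → ¬ a ∣ n →
  (∀ s → Arc n s a → s ≡ a ⊎ s ≡ b) → ∃[ j ] n ∸ a ≡ b ^ j
in-arcs⇒∸≡^ {n} {a} {b} pa va a∤n in-arcs = sole-prime-divisor⇒≡^ sole
  where
  instance _ = >-nonZero (<-trans z<s (Vertex⇒1<∸ va))
  sole : ∀ p → Prime p → p ∣ n ∸ a → p ≡ b
  sole p pp p∣n∸a with in-arcs p (∣⇒Arc pp va p∣n∸a)
  ... | inj₁ refl = contradiction (∣m∸n∣n⇒∣m a (Vertex⇒≤ va) p∣n∸a ∣-refl) a∤n
  ... | inj₂ p≡b = p≡b

∸≡^⇒exponent>1 : ∀ {n a b j} → Vertex n a → n ∸ a ≡ b ^ j → b + a ≢ n → 1 < j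
∸≡^⇒exponent>1 {j = zero} va n∸a≡1 _ = contradiction n∸a≡1 (>⇒≢ (Vertex⇒1<∸ va))
∸≡^⇒exponent>1 {n} {a} {b} {j = suc zero} va n∸a≡b*1 b+a≢n = contradiction (begin
  b + a            ≡⟨ cong (_+ a) (trans (sym (*-identityʳ b)) (sym n∸a≡b*1)) ⟩
  n ∸ a + a        ≡⟨ m∸n+n≡m (Vertex⇒≤ va) ⟩
  n                ∎) b+a≢n
  where open ≡-Reasoning
∸≡^⇒exponent>1 {j = suc (suc _)} _ _ _ = s≤s (s≤s z≤n)

pair-component⇒≡^+ : ∀ {n a b} {U : VSet} → IsAutonomousComponent n U →
  U ⊆ Pair a b → U a → U b → Prime a → Prime b → a ≢ b → b + a ≢ n →
  ¬ a ∣ n × ∃[ j ] (1 < j × b ^ j + a ≡ n)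
pair-component⇒≡^+ {n} {a} {b} component@((U⊆V , _ , closedU) , _) U⊆ab Ua Ub pa pb a≢b b+a≢n =
  let j , n∸a≡b^j = in-arcs⇒∸≡^ pa va a∤n (λ s arc → U⊆ab s (closedU s a arc Ua))
  in a∤n , j , ∸≡^⇒exponent>1 va n∸a≡b^j b+a≢n ,
     trans (cong (_+ a) (sym n∸a≡b^j)) (m∸n+n≡m (Vertex⇒≤ va))
  where
  va : Vertex n a
  va = U⊆V a Ua
  a∤n : ¬ a ∣ n
  a∤n = ∣∸Vertex⇒∤ pa pb a≢b (U⊆V b Ub)
    (pair-component⇒∣ component (λ v → ⊎-swap ∘ U⊆ab v) Ub Ua (≢-sym a≢b))

^-pair-component : ∀ {n a b x y} → Prime a → Prime b → 0 < x → 0 < y →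
  a ^ x + b ≡ n → b ^ y + a ≡ n → IsAutonomousComponent n (Pair a b)
^-pair-component {n} {a} {b} {x} {y} pa pb 0<x 0<y a^x+b≡n b^y+a≡n =
  (Pair⊆V , (a , inj₁ refl) , closed) , minimal
  where
  va : Vertex n a
  va = +≡⇒Vertex pa (^-monoʳ-< b (prime⇒>1 pb) 0<y) b^y+a≡n
  vb : Vertex n b
  vb = +≡⇒Vertex pb (^-monoʳ-< a (prime⇒>1 pa) 0<x) a^x+b≡n
  Pair⊆V : Pair a b ⊆ Vertex n
  Pair⊆V _ (inj₁ refl) = va
  Pair⊆V _ (inj₂ refl) = vb
  closed : ∀ s t → Arc n s t → Pair a b t → Pair a b s
  closed s _ ((ps , _) , _ , s∣) (inj₁ refl) =
    inj₂ (prime∣^⇒≡ y ps pb (subst (s ∣_) (+≡⇒∸≡ b^y+a≡n) s∣))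
  closed s _ ((ps , _) , _ , s∣) (inj₂ refl) =
    inj₁ (prime∣^⇒≡ x ps pa (subst (s ∣_) (+≡⇒∸≡ a^x+b≡n) s∣))
  b→a : Arc n b a
  b→a = ∣⇒Arc pb va (subst (b ∣_) (sym (+≡⇒∸≡ b^y+a≡n)) (m∣m^ b 0<y))
  a→b : Arc n a b
  a→b = ∣⇒Arc pa vb (subst (a ∣_) (sym (+≡⇒∸≡ a^x+b≡n)) (m∣m^ a 0<x))
  minimal : ∀ W → IsClosed n W → W ⊆ Pair a b → Pair a b ⊆ W
  minimal W (_ , (w , Ww) , closedW) W⊆ab with W⊆ab w Ww
  ... | inj₁ refl = λ { _ (inj₁ refl) → Ww ; _ (inj₂ refl) → closedW b a b→a Ww }
  ... | inj₂ refl = λ { _ (inj₁ refl) → closedW a b a→b Ww ; _ (inj₂ refl) → Ww }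

pair-component⇒exponents : ∀ {n a b} → Prime a → Prime b → 2 ∣ n →
  IsAutonomousComponent n (Pair a b) → a ≢ b → a + b ≢ n →
  2 < a × 2 < b × ∃[ x ] ∃[ y ] (1 < x × 1 < y × x ≢ y × a ^ x + b ≡ b ^ y + a)
pair-component⇒exponents {a = a} {b} pa pb 2∣n component a≢b a+b≢n
  with pair-component⇒≡^+ component (λ _ → id) (inj₁ refl) (inj₂ refl) pa pb a≢b
         (a+b≢n ∘ trans (+-comm a b))
     | pair-component⇒≡^+ component (λ _ → ⊎-swap) (inj₂ refl) (inj₁ refl) pb pa (≢-sym a≢b) a+b≢n
... | a∤n , j , 1<j , b^j+a≡n | b∤n , k , 1<k , a^k+b≡n =
  prime∤even⇒>2 pa 2∣n a∤n , prime∤even⇒>2 pb 2∣n b∤n , k , j , 1<k , 1<j , k≢j , a^k+b≡b^j+a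
  where
  a^k+b≡b^j+a : a ^ k + b ≡ b ^ j + a
  a^k+b≡b^j+a = trans a^k+b≡n (sym b^j+a≡n)
  k≢j : k ≢ j
  k≢j refl = ^+≢^+ (<-trans z<s (prime⇒>1 pa)) (<-trans z<s (prime⇒>1 pb)) a≢b 1<k
    a^k+b≡b^j+a

twinEAC⇒exponents : ∀ {n a b} → Prime a → Prime b → 2 ∣ n → IsTwinEAC n (Pair a b) →
  2 < a × 2 < b × ∃[ x ] ∃[ y ] (1 < x × 1 < y × x ≢ y × a ^ x + b ≡ b ^ y + a)
twinEAC⇒exponents pa pb 2∣n ((component , _ , ¬gac) , _ , _ , u≢v , ab≐uv) =
  pair-component⇒exponents pa pb 2∣n component (Pair≐Pair⇒≢ u≢v ab≐uv)
    (¬gac ∘ Equivalence.from (Pair-IsGAC⇔ component))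

exponents⇒twinEAC : ∀ {a b x y} → Prime a → Prime b → 2 < a → 2 < b → 1 < x → 1 < y → x ≢ y →
  a ^ x + b ≡ b ^ y + a → 2 ∣ a ^ x + b × 4 ≤ a ^ x + b × IsTwinEAC (a ^ x + b) (Pair a b)
exponents⇒twinEAC {a} {b} {x} {y} pa pb 2<a 2<b 1<x 1<y x≢y a^x+b≡b^y+a =
  odd+odd⇒even (odd-prime^⇒odd x pa 2<a) (odd-prime⇒odd pb 2<b) ,
  +-mono-≤ (m^n>0 a x) 2<b ,
  ((component , ¬tac , ¬gac) , a , b , a≢b , λ _ → mk⇔ id id)
  where
  instance _ = prime⇒nonZero pa
  a≢b : a ≢ b
  a≢b refl = x≢y (^-injectiveʳ (prime⇒>1 pa) (+-cancelʳ-≡ a _ _ a^x+b≡b^y+a))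
  component : IsAutonomousComponent (a ^ x + b) (Pair a b)
  component = ^-pair-component pa pb (<-trans z<s 1<x) (<-trans z<s 1<y) refl (sym a^x+b≡b^y+a)
  ¬tac : ¬ IsTAC (a ^ x + b) (Pair a b)
  ¬tac (_ , (_ , ab≐v) , _) = a≢b (Pair≐Single⇒≡ ab≐v)
  b<b^y : b < b ^ y
  b<b^y = subst (_< b ^ y) (*-identityʳ b) (^-monoʳ-< b (prime⇒>1 pb) 1<y)
  ¬gac : ¬ IsGAC (a ^ x + b) (Pair a b)
  ¬gac gac = <⇒≢ b<b^y (+-cancelʳ-≡ a b (b ^ y)
    (trans (+-comm b a) (trans (Equivalence.to (Pair-IsGAC⇔ component) gac) a^x+b≡b^y+a)))

theorem2 : (a b : ℕ) → Prime a → Prime b →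
    (∃[ n ] (2 ∣ n × 4 ≤ n × IsTwinEAC n (Pair a b)))
    ⇔ (2 < a × 2 < b × ∃[ x ] ∃[ y ] (1 < x × 1 < y × x ≢ y × a ^ x + b ≡ b ^ y + a))
theorem2 a b pa pb = mk⇔
  (λ { (_ , 2∣n , _ , twin) → twinEAC⇒exponents pa pb 2∣n twin })
  (λ { (2<a , 2<b , x , y , 1<x , 1<y , x≢y , eq) →
         a ^ x + b , exponents⇒twinEAC pa pb 2<a 2<b 1<x 1<y x≢y eq })
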